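{- Let $N$ be a positive integer. The unique (up to translation) smallest polyomino which contains $N^2$ instances of the square tetromino is the $(N+1)\times(N+1)$ square polyomino.
   Context: Cells are the unit squares of the square lattice, indexed by integer coordinates $(x,y)$. A polyomino is a finite nonempty edge-connected set of cells; its size is its number of cells; polyominoes are considered up to translation. The square tetromino is the $2\times 2$ block of cells $\{(0,0),(1,0),(0,1),(1,1)\}$. An instance of a shape is a translate of it; an instance in $P$ is one contained in $P$. "Contains $N^2$ instances" means contains at least $N^2$ distinct instances. -}

module Defs where

open import Data.Nat using (ℕ; _≤_)
open import Data.Integer using (ℤ; 0ℤ; 1ℤ; _+_; +_) renaming (_≤_ to _≤ℤ_; _<_ to _<ℤ_)
open import Data.Product using (_×_; _,_; ∃)
open import Data.Sum using (_⊎_)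
open import Data.List using (List; []; _∷_; length)
open import Data.List.Membership.Propositional using (_∈_)
open import Data.List.Relation.Unary.All using (All)
open import Data.List.Relation.Unary.Unique.Propositional using (Unique)
open import Relation.Binary.PropositionalEquality using (_≡_; _≢_)
open import Function.Bundles using (_⇔_)

Cell : Set
Cell = ℤ × ℤ

_⊕_ : Cell → Cell → Cell
(x , y) ⊕ (a , b) = (x + a , y + b)

Adjacent : Cell → Cell → Set
Adjacent (x , y) (x' , y') =
  ((x' ≡ x + 1ℤ) × (y' ≡ y)) ⊎ ((x ≡ x' + 1ℤ) × (y' ≡ y)) ⊎
  ((y' ≡ y + 1ℤ) × (x' ≡ x)) ⊎ ((y ≡ y' + 1ℤ) × (x' ≡ x))

data Path (S : List Cell) : Cell → Cell → Set where
  stop : ∀ {c} → c ∈ S → Path S c c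
  step : ∀ {c d e} → c ∈ S → Adjacent c d → Path S d e → Path S c e

record Polyomino : Set where
  field
    cells     : List Cell
    unique    : Unique cells
    nonempty  : cells ≢ []
    connected : ∀ {c d} → c ∈ cells → d ∈ cells → Path cells c d
open Polyomino public

size : Polyomino → ℕ
size P = length (cells P)

squareTetromino : List Cell
squareTetromino = (0ℤ , 0ℤ) ∷ (1ℤ , 0ℤ) ∷ (0ℤ , 1ℤ) ∷ (1ℤ , 1ℤ) ∷ []

InstanceIn : Polyomino → Cell → Set
InstanceIn P v = All (λ e → (e ⊕ v) ∈ cells P) squareTetromino

-- P contains at least k distinct instances of the square tetromino
-- (distinct instances of a fixed shape ↔ distinct translation vectors)
ContainsInstances : Polyomino → ℕ → Set
ContainsInstances P k =
  ∃ λ (vs : List Cell) → Unique vs × (k ≤ length vs) × All (InstanceIn P) vs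

TranslationEquivalent : Polyomino → Polyomino → Set
TranslationEquivalent P Q = ∃ λ (v : Cell) → ∀ (c : Cell) → (c ∈ cells P) ⇔ ((c ⊕ v) ∈ cells Q)

InSquare : ℕ → Cell → Set
InSquare m (x , y) = (0ℤ ≤ℤ x) × (x <ℤ + m) × (0ℤ ≤ℤ y) × (y <ℤ + m)

IsSquare : ℕ → Polyomino → Set
IsSquare m P = ∀ (c : Cell) → (c ∈ cells P) ⇔ InSquare m c

-- Let B be the set of lower-left corners of N² instances in P, with c distinct columns
-- and r distinct rows; then N² ≤ |B| ≤ c r, so c + r ≥ 2N by AM-GM. P contains
-- T = B ∪ (B + (1,0)), which has at least one cell more than B in each row (right of the
-- row's last corner), and T ∪ (T + (0,1)), which has at least one cell more than T in each
-- column of T, of which there are at least c + 1. Hence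
-- |P| ≥ |B| + r + c + 1 ≥ N² + 2N + 1 = (N+1)².
-- In the equality case |B| = N² and c = r = N, so B is the full grid X × Y of its columns
-- and rows, and P ⊇ (X ∪ (X+1)) × (Y ∪ (Y+1)). Counting once more gives
-- |X ∪ (X+1)| = |X| + 1, so X (and likewise Y) is a run of consecutive integers and P is a
-- translate of the (N+1) × (N+1) square.
module Submission where

open import Defs
open import Data.Nat
  using (ℕ; zero; suc; _+_; _*_; _≤_; _<_; z≤n; s≤s; s≤s⁻¹; _≤?_; ∣_-_∣; NonZero; >-nonZero⁻¹)
open import Data.Nat.Properties
  using ( ≤-trans; ≤-antisym; ≤-total; ≤-reflexive; <-trans; n<1+n; m<n⇒m<1+n; n≮n
        ; <⇒≢; ≤⇒≯; <⇒≱; ≰⇒>; m≤m+n; m≤n⇒∃[o]m+o≡n; +-comm; +-identityʳ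
        ; +-mono-≤; +-monoˡ-≤; +-monoʳ-≤; +-cancelˡ-≤; +-cancelʳ-≤
        ; *-comm; *-mono-<; *-monoˡ-≤; *-monoʳ-≤; *-cancelˡ-≡; *-cancelˡ-≤; *-cancelʳ-≤
        ; ∣m-m+n∣≡n; ∣-∣-comm; ∣m-n∣≡0⇒m≡n; module ≤-Reasoning )
import Data.Nat.Tactic.RingSolver as ℕ-Solver
open import Data.Integer using (ℤ; +_; 0ℤ; 1ℤ; -_; +≤+; +<+)
  renaming (suc to sucℤ; _+_ to _+ℤ_; _≤_ to _≤ℤ_; _<_ to _<ℤ_)
import Data.Integer.Properties as ℤ
open import Data.Integer.Tactic.RingSolver using (solve-∀)
open import Data.Product using (_×_; ∃; _,_; proj₁; proj₂)
open import Data.Product.Properties using (≡-dec)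
open import Data.Sum using (_⊎_; inj₁; inj₂; [_,_]′)
open import Data.List using (List; []; _∷_; length; map; filter; _++_; deduplicate; applyUpTo; cartesianProduct)
open import Data.List.Properties using (length-removeAt′; length-map; length-++; length-applyUpTo)
open import Data.List.Extrema ℤ.≤-totalOrder
  using (argmax; argmin; argmax-sel; argmin-sel; f[xs]≤f[argmax]; f[argmin]≤f[xs])
open import Data.List.Relation.Unary.Any using (here; there; _─_; index)
open import Data.List.Relation.Unary.All as All using (All; []; _∷_)
open import Data.List.Relation.Unary.AllPairs using (_∷_)
open import Data.List.Relation.Unary.Unique.Propositional using (Unique)
open import Data.List.Relation.Unary.Unique.Propositional.Properties
  using (++⁺; map⁺; filter⁺; applyUpTo⁺₁; cartesianProduct⁺)
import Data.List.Relation.Unary.Unique.DecPropositional.Properties as UniqueDec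
open import Data.List.Membership.Propositional using (_∈_; _∉_)
open import Data.List.Membership.DecPropositional using (_∈?_)
open import Data.List.Membership.Propositional.Properties
  using ( ∈-map⁺; ∈-map⁻; ∈-++⁺ˡ; ∈-++⁺ʳ; ∈-++⁻; ∈-filter⁺; ∈-filter⁻; ∈-deduplicate⁺; ∈-deduplicate⁻
        ; ∈-applyUpTo⁺; ∈-applyUpTo⁻; ∈-cartesianProduct⁺; ∈-cartesianProduct⁻ )
open import Data.List.Relation.Binary.Subset.Propositional using (_⊆_)
open import Data.List.Relation.Binary.Subset.Propositional.Properties using (∈-∷⁺ʳ)
open import Function using (id; _∘_; case_of_)
open import Function.Bundles using (_⇔_; mk⇔; Equivalence)
open import Function.Construct.Composition using (_⇔-∘_)
open import Relation.Binary.Definitions using (DecidableEquality)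
open import Relation.Binary.PropositionalEquality
  using (_≡_; _≢_; refl; sym; trans; cong; cong₂; subst; subst₂; module ≡-Reasoning)
open import Relation.Nullary using (yes; no; ¬?; contradiction)
open import Relation.Unary using (Decidable)

module _ {A : Set} where

  private variable
    x z : A
    xs ys : List A

  ∈-─ : (x∈ys : x ∈ ys) → z ∈ ys → z ≢ x → z ∈ (ys ─ x∈ys)
  ∈-─ (here refl)  (here refl)  z≢x = contradiction refl z≢x
  ∈-─ (here _)     (there z∈ys) _   = z∈ys
  ∈-─ (there _)    (here refl)  _   = here refl
  ∈-─ (there x∈ys) (there z∈ys) z≢x = there (∈-─ x∈ys z∈ys z≢x)

  length-mono-⊆ : Unique xs → xs ⊆ ys → length xs ≤ length ys
  length-mono-⊆ {[]}              _            _     = z≤n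
  length-mono-⊆ {x ∷ xs} {ys} (x∉xs ∷ !xs) xs⊆ys = begin
    suc (length xs)          ≤⟨ s≤s (length-mono-⊆ !xs xs⊆ys─x) ⟩
    suc (length (ys ─ x∈ys)) ≡⟨ length-removeAt′ ys (index x∈ys) ⟨
    length ys                ∎
    where
    open ≤-Reasoning
    x∈ys : x ∈ ys
    x∈ys = xs⊆ys (here refl)
    xs⊆ys─x : xs ⊆ (ys ─ x∈ys)
    xs⊆ys─x z∈xs = ∈-─ x∈ys (xs⊆ys (there z∈xs)) λ z≡x → All.lookup x∉xs z∈xs (sym z≡x)

  ⊆∧length≤⇒⊇ : DecidableEquality A → Unique xs → xs ⊆ ys → length ys ≤ length xs → ys ⊆ xs
  ⊆∧length≤⇒⊇ {xs = xs} _≟_ !xs xs⊆ys ys≤xs {z} z∈ys with _∈?_ _≟_ z xs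
  ... | yes z∈xs = z∈xs
  ... | no  z∉xs = contradiction (≤-trans (length-mono-⊆ !z∷xs (∈-∷⁺ʳ z∈ys xs⊆ys)) ys≤xs) (n≮n _)
    where
    !z∷xs : Unique (z ∷ xs)
    !z∷xs = All.tabulate (λ w∈xs z≡w → z∉xs (subst (_∈ xs) (sym z≡w) w∈xs)) ∷ !xs

length-cartesianProduct : ∀ {A B : Set} (xs : List A) (ys : List B) →
                          length (cartesianProduct xs ys) ≡ length xs * length ys
length-cartesianProduct []       ys = refl
length-cartesianProduct (x ∷ xs) ys = begin
  length (map (x ,_) ys ++ cartesianProduct xs ys)          ≡⟨ length-++ (map (x ,_) ys) ⟩
  length (map (x ,_) ys) + length (cartesianProduct xs ys)  ≡⟨ cong₂ _+_ (length-map (x ,_) ys)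
                                                                         (length-cartesianProduct xs ys) ⟩
  length ys + length xs * length ys                         ∎
  where open ≡-Reasoning

module _ {A : Set} (f : A → ℤ) {w : A} {xs : List A} (w∈xs : w ∈ xs) where

  argmax-∈ : argmax f w xs ∈ xs
  argmax-∈ = [ (λ argmax≡w → subst (_∈ xs) (sym argmax≡w) w∈xs) , id ]′ (argmax-sel f w xs)

  argmin-∈ : argmin f w xs ∈ xs
  argmin-∈ = [ (λ argmin≡w → subst (_∈ xs) (sym argmin≡w) w∈xs) , id ]′ (argmin-sel f w xs)

private
  square-sum-of-≤ : ∀ c d → (c + (c + d)) * (c + (c + d)) ≡ 4 * (c * (c + d)) + d * d
  square-sum-of-≤ = ℕ-Solver.solve-∀

  square-double : ∀ n → (n + n) * (n + n) ≡ 4 * (n * n)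
  square-double = ℕ-Solver.solve-∀

  double : ∀ n → 2 * n ≡ n + n
  double = ℕ-Solver.solve-∀

  suc-square : ∀ n → suc n * suc n ≡ suc (n * n + (n + n))
  suc-square = ℕ-Solver.solve-∀

  suc-rearrange : ∀ b r c → b + r + suc c ≡ suc (b + (c + r))
  suc-rearrange = ℕ-Solver.solve-∀

  square≤0⇒≡0 : ∀ d → d * d ≤ 0 → d ≡ 0
  square≤0⇒≡0 zero    _  = refl
  square≤0⇒≡0 (suc _) ()

square-sum : ∀ c r → (c + r) * (c + r) ≡ 4 * (c * r) + ∣ c - r ∣ * ∣ c - r ∣
square-sum c r with ≤-total c r
... | inj₁ c≤r with d , refl ← m≤n⇒∃[o]m+o≡n c≤r rewrite ∣m-m+n∣≡n c d = square-sum-of-≤ c d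
... | inj₂ r≤c with d , refl ← m≤n⇒∃[o]m+o≡n r≤c
  rewrite +-comm c r | *-comm c r | ∣-∣-comm c r | ∣m-m+n∣≡n r d = square-sum-of-≤ r d

m*m≤n*n⇒m≤n : ∀ {m n} → m * m ≤ n * n → m ≤ n
m*m≤n*n⇒m≤n {m} {n} m²≤n² with m ≤? n
... | yes m≤n = m≤n
... | no  m≰n = contradiction m²≤n² (<⇒≱ (*-mono-< (≰⇒> m≰n) (≰⇒> m≰n)))

am-gm : ∀ {n c r} → n * n ≤ c * r → n + n ≤ c + r
am-gm {n} {c} {r} n²≤cr = m*m≤n*n⇒m≤n (begin
  (n + n) * (n + n)                    ≡⟨ square-double n ⟩
  4 * (n * n)                          ≤⟨ *-monoʳ-≤ 4 n²≤cr ⟩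
  4 * (c * r)                          ≤⟨ m≤m+n _ _ ⟩
  4 * (c * r) + ∣ c - r ∣ * ∣ c - r ∣  ≡⟨ square-sum c r ⟨
  (c + r) * (c + r)                    ∎)
  where open ≤-Reasoning

am-gm-tight : ∀ {n c r} → n * n ≤ c * r → c + r ≡ n + n → c ≡ n × r ≡ n
am-gm-tight {n} {c} {r} n²≤cr c+r≡2n = c≡n , trans (sym c≡r) c≡n
  where
  open ≤-Reasoning
  d²≤0 : 4 * (c * r) + ∣ c - r ∣ * ∣ c - r ∣ ≤ 4 * (c * r) + 0
  d²≤0 = begin
    4 * (c * r) + ∣ c - r ∣ * ∣ c - r ∣  ≡⟨ square-sum c r ⟨
    (c + r) * (c + r)                    ≡⟨ cong (λ m → m * m) c+r≡2n ⟩
    (n + n) * (n + n)                    ≡⟨ square-double n ⟩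
    4 * (n * n)                          ≤⟨ *-monoʳ-≤ 4 n²≤cr ⟩
    4 * (c * r)                          ≡⟨ +-identityʳ _ ⟨
    4 * (c * r) + 0                      ∎
  c≡r : c ≡ r
  c≡r = ∣m-n∣≡0⇒m≡n (square≤0⇒≡0 ∣ c - r ∣ (+-cancelˡ-≤ (4 * (c * r)) _ 0 d²≤0))
  c≡n : c ≡ n
  c≡n = *-cancelˡ-≡ c n 2 (trans (double c) (trans (cong (λ m → c + m) c≡r) (trans c+r≡2n (sym (double n)))))

square-count-bound : ∀ {n b c r} → n * n ≤ b → b ≤ c * r → suc n * suc n ≤ b + r + suc c
square-count-bound {n} {b} {c} {r} n²≤b b≤cr = begin
  suc n * suc n          ≡⟨ suc-square n ⟩
  suc (n * n + (n + n))  ≤⟨ s≤s (+-mono-≤ n²≤b (am-gm {n} {c} {r} (≤-trans n²≤b b≤cr))) ⟩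
  suc (b + (c + r))      ≡⟨ suc-rearrange b r c ⟨
  b + r + suc c          ∎
  where open ≤-Reasoning

square-count-tight : ∀ {n b c r} → n * n ≤ b → b ≤ c * r → b + r + suc c ≤ suc n * suc n →
                     b ≡ n * n × c ≡ n × r ≡ n
square-count-tight {n} {b} {c} {r} n²≤b b≤cr tight =
  ≤-antisym b≤n² n²≤b , am-gm-tight {n} {c} {r} n²≤cr (≤-antisym c+r≤2n 2n≤c+r)
  where
  n²≤cr : n * n ≤ c * r
  n²≤cr = ≤-trans n²≤b b≤cr
  2n≤c+r : n + n ≤ c + r
  2n≤c+r = am-gm {n} {c} {r} n²≤cr
  sum≤ : b + (c + r) ≤ n * n + (n + n)
  sum≤ = s≤s⁻¹ (subst₂ _≤_ (suc-rearrange b r c) (suc-square n) tight)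
  b≤n² : b ≤ n * n
  b≤n² = +-cancelʳ-≤ (n + n) b (n * n) (≤-trans (+-monoʳ-≤ b 2n≤c+r) sum≤)
  c+r≤2n : c + r ≤ n + n
  c+r≤2n = +-cancelˡ-≤ (n * n) _ _ (≤-trans (+-monoˡ-≤ (c + r) n²≤b) sum≤)

square-squeeze : ∀ {n a b} .{{_ : NonZero n}} → n ≤ a → n ≤ b → a * b ≤ n * n → a ≡ n × b ≡ n
square-squeeze {n} {a} {b} n≤a n≤b ab≤n² =
  ≤-antisym (*-cancelʳ-≤ a n n (≤-trans (*-monoʳ-≤ a n≤b) ab≤n²)) n≤a ,
  ≤-antisym (*-cancelˡ-≤ n (≤-trans (*-monoˡ-≤ b n≤a) ab≤n²)) n≤b

module Shift {A K : Set} (_≟A_ : DecidableEquality A) (_≟K_ : DecidableEquality K)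
  (σ : A → A) (σ-injective : ∀ {a b} → σ a ≡ σ b → a ≡ b)
  (π : A → K) (π∘σ≡π : ∀ a → π (σ a) ≡ π a)
  (h : A → ℤ) (h<h∘σ : ∀ a → h a <ℤ h (σ a)) where

  private variable
    xs ys : List A

  lines : List A → List K
  lines xs = deduplicate _≟K_ (map π xs)

  lines-unique : ∀ xs → Unique (lines xs)
  lines-unique xs = UniqueDec.deduplicate-! _≟K_ (map π xs)

  ∈-lines⁺ : ∀ {a} → a ∈ xs → π a ∈ lines xs
  ∈-lines⁺ a∈xs = ∈-deduplicate⁺ _≟K_ (∈-map⁺ π a∈xs)

  ∈-lines⁻ : ∀ xs {ℓ} → ℓ ∈ lines xs → ∃ λ a → a ∈ xs × ℓ ≡ π a
  ∈-lines⁻ xs ℓ∈lines = ∈-map⁻ π (∈-deduplicate⁻ _≟K_ (map π xs) ℓ∈lines)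

  leaves? : (xs : List A) → Decidable (λ a → σ a ∉ xs)
  leaves? xs a = ¬? (_∈?_ _≟A_ (σ a) xs)

  exits : List A → List A
  exits xs = filter (leaves? xs) xs

  length+exits≤ : Unique xs → xs ⊆ ys → (∀ {a} → a ∈ xs → σ a ∈ ys) →
                  length xs + length (exits xs) ≤ length ys
  length+exits≤ {xs} {ys} !xs xs⊆ys σ[xs]⊆ys = begin
    length xs + length (exits xs)          ≡⟨ cong (λ n → length xs + n) (length-map σ (exits xs)) ⟨
    length xs + length (map σ (exits xs))  ≡⟨ length-++ xs ⟨
    length (xs ++ map σ (exits xs))        ≤⟨ length-mono-⊆ !xs++σ[exits] xs++σ[exits]⊆ys ⟩
    length ys                              ∎
    where
    open ≤-Reasoning
    exit⇒σ∉ : ∀ {a} → a ∈ exits xs → a ∈ xs × σ a ∉ xs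
    exit⇒σ∉ = ∈-filter⁻ (leaves? xs) {xs = xs}
    !xs++σ[exits] : Unique (xs ++ map σ (exits xs))
    !xs++σ[exits] = ++⁺ !xs (map⁺ σ-injective (filter⁺ (leaves? xs) !xs)) λ (v∈xs , v∈σ[exits]) →
      let a , a∈exits , v≡σa = ∈-map⁻ σ v∈σ[exits]
      in proj₂ (exit⇒σ∉ a∈exits) (subst (_∈ xs) v≡σa v∈xs)
    xs++σ[exits]⊆ys : xs ++ map σ (exits xs) ⊆ ys
    xs++σ[exits]⊆ys v∈ = [ xs⊆ys , (λ v∈σ[exits] →
      let a , a∈exits , v≡σa = ∈-map⁻ σ v∈σ[exits]
      in subst (_∈ ys) (sym v≡σa) (σ[xs]⊆ys (proj₁ (exit⇒σ∉ a∈exits)))) ]′ (∈-++⁻ xs v∈)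

  -- The highest point of each line is an exit.
  lines⊆π[exits] : lines xs ⊆ map π (exits xs)
  lines⊆π[exits] {xs} ℓ∈lines with ∈-lines⁻ xs ℓ∈lines
  ... | w , w∈xs , refl = subst (_∈ map π (exits xs)) π[top]≡π[w] (∈-map⁺ π top∈exits)
    where
    onLine? : Decidable (λ a → π a ≡ π w)
    onLine? a = π a ≟K π w
    line : List A
    line = filter onLine? xs
    top : A
    top = argmax h w line
    top∈line : top ∈ line
    top∈line = argmax-∈ h (∈-filter⁺ onLine? w∈xs refl)
    π[top]≡π[w] : π top ≡ π w
    π[top]≡π[w] = proj₂ (∈-filter⁻ onLine? {xs = xs} top∈line)
    σ[top]∉xs : σ top ∉ xs
    σ[top]∉xs σ[top]∈xs = ℤ.<⇒≱ (h<h∘σ top)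
      (All.lookup (f[xs]≤f[argmax] {f = h} w line)
        (∈-filter⁺ onLine? σ[top]∈xs (trans (π∘σ≡π top) π[top]≡π[w])))
    top∈exits : top ∈ exits xs
    top∈exits = ∈-filter⁺ (leaves? xs) (proj₁ (∈-filter⁻ onLine? {xs = xs} top∈line)) σ[top]∉xs

  length+lines≤ : Unique xs → xs ⊆ ys → (∀ {a} → a ∈ xs → σ a ∈ ys) →
                  length xs + length (lines xs) ≤ length ys
  length+lines≤ {xs} !xs xs⊆ys σ[xs]⊆ys =
    ≤-trans (+-monoʳ-≤ (length xs) lines≤exits) (length+exits≤ !xs xs⊆ys σ[xs]⊆ys)
    where
    lines≤exits : length (lines xs) ≤ length (exits xs)
    lines≤exits = subst (length (lines xs) ≤_) (length-map π (exits xs))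
      (length-mono-⊆ (lines-unique xs) lines⊆π[exits])

private
  -a+[a+i]≡i : ∀ a i → - a +ℤ (a +ℤ i) ≡ i
  -a+[a+i]≡i = solve-∀

  [a+i]-a≡i : ∀ a i → (a +ℤ i) +ℤ - a ≡ i
  [a+i]-a≡i = solve-∀

  a+[i-a]≡i : ∀ a i → a +ℤ (i +ℤ - a) ≡ i
  a+[i-a]≡i = solve-∀

  1+[a+i]≡a+[1+i] : ∀ a i → 1ℤ +ℤ (a +ℤ i) ≡ a +ℤ (1ℤ +ℤ i)
  1+[a+i]≡a+[1+i] = solve-∀

  i<sucℤ[i] : ∀ i → i <ℤ sucℤ i
  i<sucℤ[i] i = ℤ.suc[i]≤j⇒i<j ℤ.≤-refl

+ℤ-cancelˡ-≡ : ∀ a {i j} → a +ℤ i ≡ a +ℤ j → i ≡ j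
+ℤ-cancelˡ-≡ a {i} {j} eq = trans (sym (-a+[a+i]≡i a i)) (trans (cong (- a +ℤ_) eq) (-a+[a+i]≡i a j))

+ℤ-cancelˡ-≤ : ∀ a {i j} → a +ℤ i ≤ℤ a +ℤ j → i ≤ℤ j
+ℤ-cancelˡ-≤ a {i} {j} le = subst₂ _≤ℤ_ (-a+[a+i]≡i a i) (-a+[a+i]≡i a j) (ℤ.+-monoʳ-≤ (- a) le)

≤ℤ⇒≡+ : ∀ {a z} → a ≤ℤ z → ∃ λ i → z ≡ a +ℤ + i
≤ℤ⇒≡+ {a} {z} a≤z =
  _ , trans (sym (a+[i-a]≡i a z)) (cong (a +ℤ_) (sym (ℤ.0≤i⇒+∣i∣≡i (ℤ.i≤j⇒0≤j-i a≤z))))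

interval : ℤ → ℕ → List ℤ
interval a n = applyUpTo (λ i → a +ℤ + i) n

length-interval : ∀ a n → length (interval a n) ≡ n
length-interval a n = length-applyUpTo _ n

interval-unique : ∀ a n → Unique (interval a n)
interval-unique a n = applyUpTo⁺₁ _ n λ i<j _ a+i≡a+j → <⇒≢ i<j (ℤ.+-injective (+ℤ-cancelˡ-≡ a a+i≡a+j))

∈-interval⁺ : ∀ a {i n} → i < n → a +ℤ + i ∈ interval a n
∈-interval⁺ a = ∈-applyUpTo⁺ (λ i → a +ℤ + i)

∈-interval⁻ : ∀ a n {z} → z ∈ interval a n → ∃ λ i → i < n × z ≡ a +ℤ + i
∈-interval⁻ a n = ∈-applyUpTo⁻ (λ i → a +ℤ + i)

bounded⇒∈-interval : ∀ {a z k} → a ≤ℤ z → z ≤ℤ a +ℤ + k → z ∈ interval a (suc k)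
bounded⇒∈-interval {a} {z} {k} a≤z z≤a+k with i , z≡a+i ← ≤ℤ⇒≡+ a≤z =
  subst (_∈ interval a (suc k)) (sym z≡a+i)
    (∈-interval⁺ a (s≤s (ℤ.drop‿+≤+ (+ℤ-cancelˡ-≤ a (subst (_≤ℤ a +ℤ + k) z≡a+i z≤a+k)))))

∈-interval₀⇔ : ∀ n {z} → z ∈ interval 0ℤ n ⇔ (0ℤ ≤ℤ z × z <ℤ + n)
∈-interval₀⇔ n {z} = mk⇔ to from
  where
  to : z ∈ interval 0ℤ n → 0ℤ ≤ℤ z × z <ℤ + n
  to z∈ with i , i<n , refl ← ∈-interval⁻ 0ℤ n z∈ = +≤+ z≤n , +<+ i<n
  from : 0ℤ ≤ℤ z × z <ℤ + n → z ∈ interval 0ℤ n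
  from (+≤+ _ , z<n) = ∈-interval⁺ 0ℤ (ℤ.drop‿+<+ z<n)

∈-interval-translate : ∀ a n {z} → z ∈ interval a n ⇔ z +ℤ - a ∈ interval 0ℤ n
∈-interval-translate a n {z} = mk⇔ to from
  where
  to : z ∈ interval a n → z +ℤ - a ∈ interval 0ℤ n
  to z∈ with i , i<n , refl ← ∈-interval⁻ a n z∈ =
    subst (_∈ interval 0ℤ n) (sym ([a+i]-a≡i a (+ i))) (∈-interval⁺ 0ℤ i<n)
  from : z +ℤ - a ∈ interval 0ℤ n → z ∈ interval a n
  from z-a∈ with i , i<n , z-a≡i ← ∈-interval⁻ 0ℤ n z-a∈ =
    subst (_∈ interval a n) (trans (cong (a +ℤ_) (sym z-a≡i)) (a+[i-a]≡i a z)) (∈-interval⁺ a i<n)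

succ-closed⇒interval : (L : List ℤ) → Unique L → (∀ {x} → x ∈ L → sucℤ x ∈ L ⊎ All (_≤ℤ x) L) →
                       ∃ λ a → interval a (length L) ⊆ L
succ-closed⇒interval []          _  _      = 0ℤ , λ ()
succ-closed⇒interval L@(l ∷ _) !L closed =
  bottom , λ z∈ → let i , i<n , z≡ = ∈-interval⁻ bottom (length L) z∈ in subst (_∈ L) (sym z≡) (bottom+ i i<n)
  where
  bottom : ℤ
  bottom = argmin id l L
  bottom+ : ∀ k → k < length L → bottom +ℤ + k ∈ L
  bottom+ zero    _       = subst (_∈ L) (sym (ℤ.+-identityʳ bottom)) (argmin-∈ id (here refl))
  bottom+ (suc k) k+1<n with closed (bottom+ k (<-trans (n<1+n k) k+1<n))
  ... | inj₁ suc∈L = subst (_∈ L) (1+[a+i]≡a+[1+i] bottom (+ k)) suc∈L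
  ... | inj₂ L≤    = contradiction k+1<n (≤⇒≯ (subst (length L ≤_) (length-interval bottom (suc k))
                       (length-mono-⊆ !L λ z∈L →
                         bounded⇒∈-interval (All.lookup (f[argmin]≤f[xs] {f = id} l L) z∈L) (All.lookup L≤ z∈L))))

module _ {X Y : List ℤ} (!X : Unique X) {x₀ : ℤ} (x₀∈X : x₀ ∈ X)
         (X⊆Y : X ⊆ Y) (suc[X]⊆Y : ∀ {x} → x ∈ X → sucℤ x ∈ Y) where

  private
    top : ℤ
    top = argmax id x₀ X
    X≤top : All (_≤ℤ top) X
    X≤top = f[xs]≤f[argmax] {f = id} x₀ X
    !top+1∷X : Unique (sucℤ top ∷ X)
    !top+1∷X = All.map (λ x≤top top+1≡x → ℤ.<⇒≢ (ℤ.≤-<-trans x≤top (i<sucℤ[i] top)) (sym top+1≡x)) X≤top ∷ !X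
    top+1∷X⊆Y : sucℤ top ∷ X ⊆ Y
    top+1∷X⊆Y = ∈-∷⁺ʳ (suc[X]⊆Y (argmax-∈ id x₀∈X)) X⊆Y

  ∪suc-length : suc (length X) ≤ length Y
  ∪suc-length = length-mono-⊆ !top+1∷X top+1∷X⊆Y

  ∪suc-interval : Unique Y → length Y ≤ suc (length X) → ∃ λ a → interval a (length Y) ⊆ Y
  ∪suc-interval !Y Y≤X+1 = succ-closed⇒interval Y !Y closed
    where
    Y⊆top+1∷X : Y ⊆ sucℤ top ∷ X
    Y⊆top+1∷X = ⊆∧length≤⇒⊇ ℤ._≟_ !top+1∷X top+1∷X⊆Y Y≤X+1
    ≤top+1 : ∀ {y} → y ∈ Y → y ≤ℤ sucℤ top
    ≤top+1 y∈Y with Y⊆top+1∷X y∈Y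
    ... | here refl = ℤ.≤-refl
    ... | there y∈X = ℤ.≤-trans (All.lookup X≤top y∈X) (ℤ.i≤suc[i] top)
    closed : ∀ {y} → y ∈ Y → sucℤ y ∈ Y ⊎ All (_≤ℤ y) Y
    closed y∈Y with Y⊆top+1∷X y∈Y
    ... | here refl = inj₂ (All.tabulate ≤top+1)
    ... | there y∈X = inj₁ (suc[X]⊆Y y∈X)

widen : List ℤ → List ℤ
widen X = deduplicate ℤ._≟_ (X ++ map sucℤ X)

widen-unique : ∀ X → Unique (widen X)
widen-unique X = UniqueDec.deduplicate-! ℤ._≟_ (X ++ map sucℤ X)

⊆-widen : ∀ X → X ⊆ widen X
⊆-widen X x∈X = ∈-deduplicate⁺ ℤ._≟_ (∈-++⁺ˡ x∈X)

suc∈widen : ∀ X {x} → x ∈ X → sucℤ x ∈ widen X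
suc∈widen X x∈X = ∈-deduplicate⁺ ℤ._≟_ (∈-++⁺ʳ X (∈-map⁺ sucℤ x∈X))

∈-widen⁻ : ∀ X {y} → y ∈ widen X → ∃ λ x → x ∈ X × (y ≡ x ⊎ y ≡ sucℤ x)
∈-widen⁻ X y∈ with ∈-++⁻ X (∈-deduplicate⁻ ℤ._≟_ (X ++ map sucℤ X) y∈)
... | inj₁ y∈X = _ , y∈X , inj₁ refl
... | inj₂ y∈sucX with x , x∈X , refl ← ∈-map⁻ sucℤ y∈sucX = x , x∈X , inj₂ refl

widen-interval : ∀ {X x n} → Unique X → x ∈ X → length X ≡ n → length (widen X) ≤ suc n →
                 ∃ λ a → interval a (suc n) ⊆ widen X
widen-interval {X} !X x∈X refl widen≤ =
  subst (λ m → ∃ λ a → interval a m ⊆ widen X) (≤-antisym widen≤ (∪suc-length !X x∈X (⊆-widen X) (suc∈widen X)))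
    (∪suc-interval !X x∈X (⊆-widen X) (suc∈widen X) (widen-unique X) widen≤)

_≟ᶜ_ : DecidableEquality Cell
_≟ᶜ_ = ≡-dec ℤ._≟_ ℤ._≟_

right : Cell → Cell
right (x , y) = (sucℤ x , y)

up : Cell → Cell
up (x , y) = (x , sucℤ y)

private
  sucℤ-injective : ∀ {x y} → sucℤ x ≡ sucℤ y → x ≡ y
  sucℤ-injective = +ℤ-cancelˡ-≡ 1ℤ

module Rows = Shift _≟ᶜ_ ℤ._≟_ right (λ eq → cong₂ _,_ (sucℤ-injective (cong proj₁ eq)) (cong proj₂ eq))
                    proj₂ (λ _ → refl) proj₁ (λ c → i<sucℤ[i] (proj₁ c))
module Columns = Shift _≟ᶜ_ ℤ._≟_ up (λ eq → cong₂ _,_ (cong proj₁ eq) (sucℤ-injective (cong proj₂ eq)))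
                       proj₁ (λ _ → refl) proj₂ (λ c → i<sucℤ[i] (proj₂ c))

rows columns : List Cell → List ℤ
rows    = Rows.lines
columns = Columns.lines

grid : List Cell → List Cell
grid B = cartesianProduct (columns B) (rows B)

⊆-grid : ∀ B → B ⊆ grid B
⊆-grid B c∈B = ∈-cartesianProduct⁺ (Columns.∈-lines⁺ c∈B) (Rows.∈-lines⁺ c∈B)

length≤grid : ∀ {B} → Unique B → length B ≤ length (columns B) * length (rows B)
length≤grid {B} !B = subst (length B ≤_) (length-cartesianProduct (columns B) (rows B)) (length-mono-⊆ !B (⊆-grid B))

square : ℤ → ℤ → ℕ → List Cell
square a b n = cartesianProduct (interval a n) (interval b n)

square-unique : ∀ a b n → Unique (square a b n)
square-unique a b n = cartesianProduct⁺ (interval-unique a n) (interval-unique b n)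

length-square : ∀ a b n → length (square a b n) ≡ n * n
length-square a b n = trans (length-cartesianProduct (interval a n) (interval b n))
                            (cong₂ _*_ (length-interval a n) (length-interval b n))

∈-square-translate : ∀ a b n {c} → c ∈ square a b n ⇔ (c ⊕ (- a , - b)) ∈ square 0ℤ 0ℤ n
∈-square-translate a b n {x , y} = mk⇔
  (λ c∈ → let x∈ , y∈ = ∈-cartesianProduct⁻ (interval a n) (interval b n) c∈
          in ∈-cartesianProduct⁺ (Equivalence.to (∈-interval-translate a n) x∈)
                                 (Equivalence.to (∈-interval-translate b n) y∈))
  (λ c∈ → let x∈ , y∈ = ∈-cartesianProduct⁻ (interval 0ℤ n) (interval 0ℤ n) c∈
          in ∈-cartesianProduct⁺ (Equivalence.from (∈-interval-translate a n) x∈)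
                                 (Equivalence.from (∈-interval-translate b n) y∈))

Block : List Cell → Cell → Set
Block S c = c ∈ S × right c ∈ S × up c ∈ S × up (right c) ∈ S

Block-corner : ∀ {S x y x′ y′} → Block S (x , y) →
               x′ ≡ x ⊎ x′ ≡ sucℤ x → y′ ≡ y ⊎ y′ ≡ sucℤ y → (x′ , y′) ∈ S
Block-corner (c , r , u , ur) (inj₁ refl) (inj₁ refl) = c
Block-corner (c , r , u , ur) (inj₂ refl) (inj₁ refl) = r
Block-corner (c , r , u , ur) (inj₁ refl) (inj₂ refl) = u
Block-corner (c , r , u , ur) (inj₂ refl) (inj₂ refl) = ur

instance⇒Block : ∀ {P x y} → InstanceIn P (x , y) → Block (cells P) (x , y)
instance⇒Block {P} {x} {y} (c ∷ r ∷ u ∷ ur ∷ []) =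
  subst (_∈ cells P) (cong₂ _,_ (ℤ.+-identityˡ x) (ℤ.+-identityˡ y)) c ,
  subst (λ y′ → (sucℤ x , y′) ∈ cells P) (ℤ.+-identityˡ y) r ,
  subst (λ x′ → (x′ , sucℤ y) ∈ cells P) (ℤ.+-identityˡ x) u ,
  ur

module _ {S B : List Cell} (!B : Unique B) (blocks : ∀ {b} → b ∈ B → Block S b) {b₀ : Cell} (b₀∈B : b₀ ∈ B) where

  blocks-count : length B + length (rows B) + suc (length (columns B)) ≤ length S
  blocks-count = ≤-trans (+-mono-≤ (Rows.length+lines≤ !B B⊆T right[B]⊆T) columns≤)
                         (Columns.length+lines≤ (UniqueDec.deduplicate-! _≟ᶜ_ (B ++ map right B))
                                                (proj₁ ∘ T-in-S) (proj₂ ∘ T-in-S))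
    where
    T : List Cell
    T = deduplicate _≟ᶜ_ (B ++ map right B)
    B⊆T : B ⊆ T
    B⊆T b∈B = ∈-deduplicate⁺ _≟ᶜ_ (∈-++⁺ˡ b∈B)
    right[B]⊆T : ∀ {b} → b ∈ B → right b ∈ T
    right[B]⊆T b∈B = ∈-deduplicate⁺ _≟ᶜ_ (∈-++⁺ʳ B (∈-map⁺ right b∈B))
    T-in-S : ∀ {t} → t ∈ T → t ∈ S × up t ∈ S
    T-in-S t∈T with ∈-++⁻ B (∈-deduplicate⁻ _≟ᶜ_ (B ++ map right B) t∈T)
    ... | inj₁ t∈B = let c , _ , u , _ = blocks t∈B in c , u
    ... | inj₂ t∈right[B] with b , b∈B , refl ← ∈-map⁻ right t∈right[B] =
      let _ , r , _ , ur = blocks b∈B in r , ur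
    columns≤ : suc (length (columns B)) ≤ length (columns T)
    columns≤ = ∪suc-length (Columns.lines-unique B) (Columns.∈-lines⁺ b₀∈B)
      (λ x∈ → let b , b∈B , x≡ = Columns.∈-lines⁻ B x∈
              in subst (_∈ columns T) (sym x≡) (Columns.∈-lines⁺ (B⊆T b∈B)))
      (λ x∈ → let b , b∈B , x≡ = Columns.∈-lines⁻ B x∈
              in subst (λ x → sucℤ x ∈ columns T) (sym x≡) (Columns.∈-lines⁺ (right[B]⊆T b∈B)))

  module _ {n : ℕ} (n²≤B : n * n ≤ length B) (S≡ : length S ≡ suc n * suc n) where

    grid-counts : length B ≡ n * n × length (columns B) ≡ n × length (rows B) ≡ n
    grid-counts = square-count-tight {n} {length B} {length (columns B)} {length (rows B)} n²≤B (length≤grid !B)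
      (subst (length B + length (rows B) + suc (length (columns B)) ≤_) S≡ blocks-count)

    columns≡n : length (columns B) ≡ n
    columns≡n = proj₁ (proj₂ grid-counts)

    rows≡n : length (rows B) ≡ n
    rows≡n = proj₂ (proj₂ grid-counts)

    grid⊆B : grid B ⊆ B
    grid⊆B = ⊆∧length≤⇒⊇ _≟ᶜ_ !B (⊆-grid B) (≤-reflexive (begin
      length (grid B)                       ≡⟨ length-cartesianProduct (columns B) (rows B) ⟩
      length (columns B) * length (rows B)  ≡⟨ cong₂ _*_ columns≡n rows≡n ⟩
      n * n                                 ≡⟨ proj₁ grid-counts ⟨
      length B                              ∎))
      where open ≡-Reasoning

    widened-grid⊆S : cartesianProduct (widen (columns B)) (widen (rows B)) ⊆ S
    widened-grid⊆S p∈ =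
      let x′∈ , y′∈    = ∈-cartesianProduct⁻ (widen (columns B)) (widen (rows B)) p∈
          x , x∈ , x′≡ = ∈-widen⁻ (columns B) x′∈
          y , y∈ , y′≡ = ∈-widen⁻ (rows B) y′∈
      in Block-corner (blocks (grid⊆B (∈-cartesianProduct⁺ x∈ y∈))) x′≡ y′≡

    widened-lengths : length (widen (columns B)) ≡ suc n × length (widen (rows B)) ≡ suc n
    widened-lengths = square-squeeze columns≥ rows≥ product≤
      where
      columns≥ : suc n ≤ length (widen (columns B))
      columns≥ = subst (λ c → suc c ≤ length (widen (columns B))) columns≡n
        (∪suc-length (Columns.lines-unique B) (Columns.∈-lines⁺ b₀∈B) (⊆-widen (columns B)) (suc∈widen (columns B)))
      rows≥ : suc n ≤ length (widen (rows B))
      rows≥ = subst (λ r → suc r ≤ length (widen (rows B))) rows≡n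
        (∪suc-length (Rows.lines-unique B) (Rows.∈-lines⁺ b₀∈B) (⊆-widen (rows B)) (suc∈widen (rows B)))
      product≤ : length (widen (columns B)) * length (widen (rows B)) ≤ suc n * suc n
      product≤ = subst₂ _≤_ (length-cartesianProduct (widen (columns B)) (widen (rows B))) S≡
        (length-mono-⊆ (cartesianProduct⁺ (widen-unique (columns B)) (widen-unique (rows B))) widened-grid⊆S)

    blocks-in-square : ∃ λ a → ∃ λ b → square a b (suc n) ⊆ S
    blocks-in-square =
      let x₀ , X⊆ = widen-interval (Columns.lines-unique B) (Columns.∈-lines⁺ b₀∈B) columns≡n
                      (≤-reflexive (proj₁ widened-lengths))
          y₀ , Y⊆ = widen-interval (Rows.lines-unique B) (Rows.∈-lines⁺ b₀∈B) rows≡n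
                      (≤-reflexive (proj₂ widened-lengths))
      in x₀ , y₀ , λ p∈ → let x∈ , y∈ = ∈-cartesianProduct⁻ (interval x₀ (suc n)) (interval y₀ (suc n)) p∈
                          in widened-grid⊆S (∈-cartesianProduct⁺ (X⊆ x∈) (Y⊆ y∈))

path-head : ∀ {S c d} → Path S c d → c ∈ S
path-head (stop c∈S)     = c∈S
path-head (step c∈S _ _) = c∈S

Adjacent-sym : ∀ {c d} → Adjacent c d → Adjacent d c
Adjacent-sym (inj₁ (x′≡ , y′≡))               = inj₂ (inj₁ (x′≡ , sym y′≡))
Adjacent-sym (inj₂ (inj₁ (x≡ , y′≡)))         = inj₁ (x≡ , sym y′≡)
Adjacent-sym (inj₂ (inj₂ (inj₁ (y′≡ , x′≡)))) = inj₂ (inj₂ (inj₂ (y′≡ , sym x′≡)))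
Adjacent-sym (inj₂ (inj₂ (inj₂ (y≡ , x′≡))))  = inj₂ (inj₂ (inj₁ (y≡ , sym x′≡)))

Path-trans : ∀ {S c d e} → Path S c d → Path S d e → Path S c e
Path-trans (stop _)         q = q
Path-trans (step c∈S c~d p) q = step c∈S c~d (Path-trans p q)

Path-sym : ∀ {S c d} → Path S c d → Path S d c
Path-sym (stop c∈S)       = stop c∈S
Path-sym (step c∈S c~d p) = Path-trans (Path-sym p) (step (path-head p) (Adjacent-sym c~d) (stop c∈S))

∈-square₀⁺ : ∀ {i j n} → i < n → j < n → (+ i , + j) ∈ square 0ℤ 0ℤ n
∈-square₀⁺ i<n j<n = ∈-cartesianProduct⁺ (∈-interval⁺ 0ℤ i<n) (∈-interval⁺ 0ℤ j<n)

∈-square₀⁻ : ∀ n {c} → c ∈ square 0ℤ 0ℤ n → ∃ λ i → ∃ λ j → i < n × j < n × c ≡ (+ i , + j)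
∈-square₀⁻ n {x , y} c∈ with x∈ , y∈ ← ∈-cartesianProduct⁻ (interval 0ℤ n) (interval 0ℤ n) c∈
  with i , i<n , refl ← ∈-interval⁻ 0ℤ n x∈ | j , j<n , refl ← ∈-interval⁻ 0ℤ n y∈ = i , j , i<n , j<n , refl

path-to-origin : ∀ {n} i j → i < n → j < n → Path (square 0ℤ 0ℤ n) (+ i , + j) (0ℤ , 0ℤ)
path-to-origin zero    zero    i<n j<n = stop (∈-square₀⁺ i<n j<n)
path-to-origin i       (suc j) i<n j<n = step (∈-square₀⁺ i<n j<n) (inj₂ (inj₂ (inj₂ (cong +_ (+-comm 1 j) , refl))))
                                              (path-to-origin i j i<n (<-trans (n<1+n j) j<n))
path-to-origin (suc i) zero    i<n j<n = step (∈-square₀⁺ i<n j<n) (inj₂ (inj₁ (cong +_ (+-comm 1 i) , refl)))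
                                              (path-to-origin i zero (<-trans (n<1+n i) i<n) j<n)

Square : (n : ℕ) → .{{NonZero n}} → Polyomino
Square n = record
  { cells     = square 0ℤ 0ℤ n
  ; unique    = square-unique 0ℤ 0ℤ n
  ; nonempty  = λ square≡[] → case subst ((0ℤ , 0ℤ) ∈_) square≡[] (∈-square₀⁺ 0<n 0<n) of λ ()
  ; connected = λ c∈ d∈ → Path-trans (to-origin c∈) (Path-sym (to-origin d∈))
  }
  where
  0<n : 0 < n
  0<n = >-nonZero⁻¹ n
  to-origin : ∀ {c} → c ∈ square 0ℤ 0ℤ n → Path (square 0ℤ 0ℤ n) c (0ℤ , 0ℤ)
  to-origin c∈ with i , j , i<n , j<n , refl ← ∈-square₀⁻ n c∈ = path-to-origin i j i<n j<n

Square-isSquare : ∀ n .{{_ : NonZero n}} → IsSquare n (Square n)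
Square-isSquare n (x , y) = mk⇔
  (λ c∈ → let x∈ , y∈   = ∈-cartesianProduct⁻ (interval 0ℤ n) (interval 0ℤ n) c∈
              0≤x , x<n = Equivalence.to (∈-interval₀⇔ n) x∈
              0≤y , y<n = Equivalence.to (∈-interval₀⇔ n) y∈
          in 0≤x , x<n , 0≤y , y<n)
  (λ (0≤x , x<n , 0≤y , y<n) → ∈-cartesianProduct⁺ (Equivalence.from (∈-interval₀⇔ n) (0≤x , x<n))
                                                     (Equivalence.from (∈-interval₀⇔ n) (0≤y , y<n)))

Square-contains : ∀ n → ContainsInstances (Square (suc n)) (n * n)
Square-contains n = square 0ℤ 0ℤ n , square-unique 0ℤ 0ℤ n , ≤-reflexive (sym (length-square 0ℤ 0ℤ n)) ,
                    All.tabulate instance-at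
  where
  instance-at : ∀ {v} → v ∈ square 0ℤ 0ℤ n → InstanceIn (Square (suc n)) v
  instance-at v∈ with i , j , i<n , j<n , refl ← ∈-square₀⁻ n v∈ =
    ∈-square₀⁺ (m<n⇒m<1+n i<n) (m<n⇒m<1+n j<n) ∷ ∈-square₀⁺ (s≤s i<n) (m<n⇒m<1+n j<n) ∷
    ∈-square₀⁺ (m<n⇒m<1+n i<n) (s≤s j<n) ∷ ∈-square₀⁺ (s≤s i<n) (s≤s j<n) ∷ []

∃∈-if-n*n≤length : ∀ {A : Set} {n} {xs : List A} → 0 < n → n * n ≤ length xs → ∃ λ x → x ∈ xs
∃∈-if-n*n≤length {xs = []}    (s≤s _) ()
∃∈-if-n*n≤length {xs = x ∷ _} _       _  = x , here refl

module _ {N : ℕ} (0<N : 0 < N) (P : Polyomino) where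

  size-lower-bound : ContainsInstances P (N * N) → suc N * suc N ≤ size P
  size-lower-bound (B , !B , N²≤B , instances) =
    let _ , b∈B = ∃∈-if-n*n≤length {n = N} {xs = B} 0<N N²≤B
    in ≤-trans (square-count-bound {N} {length B} {length (columns B)} {length (rows B)} N²≤B (length≤grid !B))
               (blocks-count !B (λ b∈ → instance⇒Block {P} (All.lookup instances b∈)) b∈B)

  size-tight⇒square : ContainsInstances P (N * N) → size P ≡ suc N * suc N →
                      ∃ λ a → ∃ λ b → ∀ c → c ∈ cells P ⇔ c ∈ square a b (suc N)
  size-tight⇒square (B , !B , N²≤B , instances) P≡ =
    let _ , b∈B          = ∃∈-if-n*n≤length {n = N} {xs = B} 0<N N²≤B
        a , b , square⊆P = blocks-in-square !B (λ b∈ → instance⇒Block {P} (All.lookup instances b∈)) b∈B {N} N²≤B P≡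
        P⊆square         = ⊆∧length≤⇒⊇ _≟ᶜ_ (square-unique a b (suc N)) square⊆P
                             (≤-reflexive (trans P≡ (sym (length-square a b (suc N)))))
    in a , b , λ c → mk⇔ P⊆square square⊆P

theorem4p3 : (N : ℕ) → 0 < N →
    ∃ λ (S : Polyomino) → IsSquare (suc N) S × ContainsInstances S (N * N) ×
      ((P : Polyomino) → ContainsInstances P (N * N) →
        (size S ≤ size P) × (size P ≡ size S → TranslationEquivalent P S))
theorem4p3 N 0<N = Square (suc N) , Square-isSquare (suc N) , Square-contains N , minimal
  where
  size-Square : size (Square (suc N)) ≡ suc N * suc N
  size-Square = length-square 0ℤ 0ℤ (suc N)
  minimal : (P : Polyomino) → ContainsInstances P (N * N) →
            (size (Square (suc N)) ≤ size P) × (size P ≡ size (Square (suc N)) → TranslationEquivalent P (Square (suc N)))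
  minimal P instances =
    subst (_≤ size P) (sym size-Square) (size-lower-bound 0<N P instances) ,
    λ P≡ → let a , b , P⇔square = size-tight⇒square 0<N P instances (trans P≡ size-Square)
           in (- a , - b) , λ c → ∈-square-translate a b (suc N) ⇔-∘ P⇔square c
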